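{- For all words $u,w\in A^*$, $$\binom{\varphi(w)}{u}=\binom{|w|}{|u|}+\sum_{\substack{\kappa\in\mathrm{Phifac}(u)\\ v\in\mathcal{L}(u,\kappa)}}\binom{w}{v}=\binom{|w|}{|u|}+\sum_{v\in f(u)} m_{f(u)}(v)\binom{w}{v}.$$
   Context: $A=\{0,1\}$, $\varphi:A^*\to A^*$ is the morphism $\varphi(0)=01$, $\varphi(1)=10$. For words $u,x$, $\binom{u}{x}$ denotes the number of occurrences of $x$ as a subword (subsequence) of $u$; $\binom{|w|}{|u|}$ is the usual binomial coefficient of integers. A $\varphi$-factorization of a word $u$ is a factorization $u=w_0\varphi(a_1)w_1\cdots w_{k-1}\varphi(a_k)w_k$ with $k\ge1$, $a_i\in A$, $w_i\in A^*$; it is identified with (coded by) the tuple of positions $\kappa=(|w_0|,|w_0\varphi(a_1)w_1|,\ldots,|w_0\varphi(a_1)w_1\cdots w_{k-1}|)$, and $\mathrm{Phifac}(u)$ is the set of all such codes. For such $\kappa$, $\mathcal{L}(u,\kappa)=A^{|w_0|}a_1A^{|w_1|}\cdots A^{|w_{k-1}|}a_kA^{|w_k|}$, regarded as a multiset with all multiplicities $1$. If $u\in 0^*\cup 1^*$ (no $\varphi$-factorization) set $f(u)=\emptyset$; otherwise $f(u)$ is the multiset sum (multiplicities added) of the languages $\mathcal{L}(u,\kappa)$ over all $\kappa\in\mathrm{Phifac}(u)$. $m_M(v)$ denotes the multiplicity of $v$ in the multiset $M$ (zero if $v\notin M$). -}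

module Defs where

open import Data.Nat using (ℕ; zero; suc; _+_; _*_; _∸_; _≤_; _≤?_)
open import Data.Nat.Combinatorics using (_C_)
open import Data.List using (List; []; _∷_; _++_; length; map; take; drop; concatMap; upTo; filter; deduplicate)
open import Data.List.Properties using (≡-dec)
open import Data.Nat.ListAction using (sum)
open import Data.Product using (_×_; _,_)
open import Data.Sum using (_⊎_; inj₁; inj₂)
open import Data.Unit using (⊤; tt)
open import Relation.Nullary using (Dec; yes; no; ¬_)
open import Relation.Nullary.Decidable using (_×-dec_; _⊎-dec_)
open import Relation.Binary.PropositionalEquality using (_≡_; refl)
open import Relation.Binary.Definitions using (DecidableEquality)

data A : Set where
  𝟎 𝟏 : A

_≟A_ : DecidableEquality A
𝟎 ≟A 𝟎 = yes refl
𝟎 ≟A 𝟏 = no λ ()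
𝟏 ≟A 𝟎 = no λ ()
𝟏 ≟A 𝟏 = yes refl

Word : Set
Word = List A

_≟W_ : DecidableEquality Word
_≟W_ = ≡-dec _≟A_

φ : A → Word
φ 𝟎 = 𝟎 ∷ 𝟏 ∷ []
φ 𝟏 = 𝟏 ∷ 𝟎 ∷ []

φ* : Word → Word
φ* = concatMap φ

binom : Word → Word → ℕ
binom u       []      = 1
binom []      (_ ∷ _) = 0
binom (a ∷ u) (b ∷ x) with a ≟A b
... | yes _ = binom u x + binom u (b ∷ x)
... | no  _ = binom u (b ∷ x)

allWords : ℕ → List Word
allWords zero    = [] ∷ []
allWords (suc n) = concatMap (λ w → (𝟎 ∷ w) ∷ (𝟏 ∷ w) ∷ []) (allWords n)

sublists : {X : Set} → List X → List (List X)
sublists []       = [] ∷ []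
sublists (x ∷ xs) = map (x ∷_) (sublists xs) ++ sublists xs

PhiAt : Word → ℕ → Set
PhiAt u p = (take 2 (drop p u) ≡ φ 𝟎) ⊎ (take 2 (drop p u) ≡ φ 𝟏)

PhiAt? : ∀ u p → Dec (PhiAt u p)
PhiAt? u p = (take 2 (drop p u) ≟W φ 𝟎) ⊎-dec (take 2 (drop p u) ≟W φ 𝟏)

-- CodesFrom u m κ : κ = (p_i, ..., p_k) are the positions of the blocks φ(a_i),...,φ(a_k)
-- of a factorization of the suffix of u starting at position m:
-- m ≤ p_i, blocks do not overlap (p_{j+1} ≥ p_j + 2), p_j + 2 ≤ |u|.
CodesFrom : Word → ℕ → List ℕ → Set
CodesFrom u m []       = ⊤
CodesFrom u m (p ∷ ps) = (m ≤ p) × (p + 2 ≤ length u) × PhiAt u p × CodesFrom u (p + 2) ps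

CodesFrom? : ∀ u m κ → Dec (CodesFrom u m κ)
CodesFrom? u m []       = yes tt
CodesFrom? u m (p ∷ ps) = (m ≤? p) ×-dec ((p + 2 ≤? length u) ×-dec (PhiAt? u p ×-dec CodesFrom? u (p + 2) ps))

IsPhifacCode : Word → List ℕ → Set
IsPhifacCode u []      = Data.Empty.⊥
  where import Data.Empty
IsPhifacCode u (p ∷ ps) = CodesFrom u 0 (p ∷ ps)

IsPhifacCode? : ∀ u κ → Dec (IsPhifacCode u κ)
IsPhifacCode? u []       = no λ ()
IsPhifacCode? u (p ∷ ps) = CodesFrom? u 0 (p ∷ ps)

Phifac : Word → List (List ℕ)
Phifac u = filter (IsPhifacCode? u) (sublists (upTo (length u)))

-- Language A^{|w_{i-1}|} a_i A^{|w_i|} ⋯ a_k A^{|w_k|} for the part of u from position m,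
-- where a_j is the first letter of the block φ(a_j) at position p_j (take 1 (drop p_j u) = a_j).
LangFrom : Word → ℕ → List ℕ → List Word
LangFrom u m []       = allWords (length u ∸ m)
LangFrom u m (p ∷ ps) =
  concatMap (λ x → map (λ y → x ++ take 1 (drop p u) ++ y) (LangFrom u (p + 2) ps))
            (allWords (p ∸ m))

𝓛 : Word → List ℕ → List Word
𝓛 u κ = LangFrom u 0 κ

Multiset : Set
Multiset = List Word

mult : Multiset → Word → ℕ
mult M v = length (filter (v ≟W_) M)

-- f(u): multiset sum of the 𝓛(u,κ), κ ∈ Phifac(u)  (empty when u ∈ 0* ∪ 1*, as Phifac(u) = ∅)
f : Word → Multiset
f u = concatMap (𝓛 u) (Phifac u)

sumPhifac : Word → Word → ℕ
sumPhifac u w = sum (map (λ κ → sum (map (binom w) (𝓛 u κ))) (Phifac u))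

sumF : Word → Word → ℕ
sumF u w = sum (map (λ v → mult (f u) v * binom w v) (deduplicate _≟W_ (f u)))

-- Subword counts in φ(w) are linear in those of w: expanding binom (φ (a w)) u along the first block
-- φ(a) gives binom (φ w) u = Σ_{v ∈ P u} binom w v for a multiset P u defined by recursion on the first
-- letters of u. Enumerating candidate codes position by position, the codes of the suffix
-- of u from position m split into those with a block at m and those without, and this split follows the
-- same recursion; so P u is the multiset sum of the 𝓛(u, κ) over all codes, the empty code included.
-- The empty code contributes A^|u|, on which the subword counts of w add up to binom |w| |u|.
module Submission where

open import Defs
open import Data.Bool using (true; false; if_then_else_)
open import Data.Empty using (⊥-elim)
open import Data.List
  using (List; []; _∷_; _++_; length; map; concatMap; filter; take; drop; applyUpTo; upTo; deduplicate)
open import Data.List.Membership.Propositional using (_∈_)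
open import Data.List.Membership.Propositional.Properties using (∈-deduplicate⁺)
open import Data.List.Properties using (map-++; map-∘; map-cong; map-cong-local; length-drop)
open import Data.List.Relation.Unary.All as All using (All; []; _∷_)
open import Data.List.Relation.Unary.All.Properties using (++⁺; map⁺)
open import Data.List.Relation.Unary.AllPairs using (_∷_)
open import Data.List.Relation.Unary.Any using (here; there)
open import Data.List.Relation.Unary.Unique.Propositional using (Unique)
open import Data.List.Relation.Unary.Unique.DecPropositional.Properties using (deduplicate-!)
open import Data.Nat using (ℕ; zero; suc; _+_; _*_; _∸_; _≤_; s≤s; z≤n)
open import Data.Nat.Combinatorics using (_C_; nCk+nC[k+1]≡[n+1]C[k+1])
open import Data.Nat.ListAction using (sum)
open import Data.Nat.ListAction.Properties using (sum-++)
open import Data.Nat.Properties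
open import Algebra.Properties.CommutativeSemigroup +-commutativeSemigroup using (interchange; x∙yz≈y∙xz)
open import Data.Product using (_,_; _×_)
open import Data.Sum using (_⊎_; inj₁; inj₂)
open import Data.Unit using (tt)
open import Function using (_∘_)
open import Relation.Binary.Definitions using (DecidableEquality)
open import Relation.Binary.PropositionalEquality
  using (_≡_; refl; sym; trans; cong; cong₂; subst; module ≡-Reasoning)
open import Relation.Nullary using (Dec; yes; no; does; ¬_)
open import Relation.Unary using (Decidable)

private
  variable
    X Y : Set

∑ : List X → (X → ℕ) → ℕ
∑ xs h = sum (map h xs)

infixr 6.5 ∑
syntax ∑ xs (λ x → e) = ∑[ x ← xs ] e

∑-++ : ∀ (xs ys : List X) h → ∑ (xs ++ ys) h ≡ ∑ xs h + ∑ ys h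
∑-++ xs ys h = trans (cong sum (map-++ h xs ys)) (sum-++ (map h xs) (map h ys))

∑-map : ∀ (f : X → Y) xs h → ∑ (map f xs) h ≡ ∑[ x ← xs ] h (f x)
∑-map f xs h = cong sum (sym (map-∘ xs))

∑-concatMap : ∀ (F : X → List Y) xs h → ∑ (concatMap F xs) h ≡ ∑[ x ← xs ] ∑ (F x) h
∑-concatMap F []       h = refl
∑-concatMap F (x ∷ xs) h = trans (∑-++ (F x) _ h) (cong (∑ (F x) h +_) (∑-concatMap F xs h))

∑-+ : ∀ (xs : List X) g h → ∑[ x ← xs ] (g x + h x) ≡ ∑ xs g + ∑ xs h
∑-+ []       g h = refl
∑-+ (x ∷ xs) g h = trans (cong (g x + h x +_) (∑-+ xs g h)) (interchange (g x) (h x) _ _)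

∑-zero : ∀ (xs : List X) → ∑[ x ← xs ] 0 ≡ 0
∑-zero []       = refl
∑-zero (x ∷ xs) = ∑-zero xs

∑-cong : ∀ (xs : List X) {g h} → (∀ x → g x ≡ h x) → ∑ xs g ≡ ∑ xs h
∑-cong xs e = cong sum (map-cong e xs)

∑-cong-local : ∀ {P : X → Set} {xs g h} → All P xs → (∀ {x} → P x → g x ≡ h x) → ∑ xs g ≡ ∑ xs h
∑-cong-local ps e = cong sum (map-cong-local (All.map e ps))

[_]·_ : {P : Set} → Dec P → ℕ → ℕ
[ p ]· x = if does p then x else 0

infixr 7 [_]·_

module _ {P : Set} where

  []·-yes : (p : Dec P) {x : ℕ} → P → [ p ]· x ≡ x
  []·-yes (yes _)  _  = refl
  []·-yes (no ¬P)  pf = ⊥-elim (¬P pf)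

  []·-no : (p : Dec P) {x : ℕ} → ¬ P → [ p ]· x ≡ 0
  []·-no (yes pf) ¬P = ⊥-elim (¬P pf)
  []·-no (no _)   _  = refl

  []·-+ : (p : Dec P) (x y : ℕ) → [ p ]· (x + y) ≡ [ p ]· x + [ p ]· y
  []·-+ (yes _) x y = refl
  []·-+ (no _)  x y = refl

  []·-cong : ∀ {Q : Set} (p : Dec P) (q : Dec Q) {x y : ℕ} →
             (P → Q) → (Q → P) → x ≡ y → [ p ]· x ≡ [ q ]· y
  []·-cong (yes _)  (yes _)  _   _   x≡y = x≡y
  []·-cong (yes pf) (no ¬Q)  P⇒Q _   _   = ⊥-elim (¬Q (P⇒Q pf))
  []·-cong (no ¬P)  (yes qf) _   Q⇒P _   = ⊥-elim (¬P (Q⇒P qf))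
  []·-cong (no _)   (no _)   _   _   _   = refl

∑-filter : ∀ {P : X → Set} (P? : Decidable P) xs h → ∑ (filter P? xs) h ≡ ∑[ x ← xs ] [ P? x ]· h x
∑-filter P? []       h = refl
∑-filter P? (x ∷ xs) h with does (P? x)
... | true  = cong (h x +_) (∑-filter P? xs h)
... | false = ∑-filter P? xs h

∑-sublists-[] : ∀ (xs : List X) {h h′ : List X → ℕ} → h′ [] ≡ 0 → (∀ x κ → h (x ∷ κ) ≡ h′ (x ∷ κ)) →
                ∑ (sublists xs) h ≡ h [] + ∑ (sublists xs) h′
∑-sublists-[] []       {h} h′[]≡0 _ = cong (λ z → h [] + (z + 0)) (sym h′[]≡0)
∑-sublists-[] (x ∷ xs) {h} {h′} h′[]≡0 e = begin
    ∑ (map (x ∷_) S ++ S) h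
  ≡⟨ ∑-++ (map (x ∷_) S) S h ⟩
    ∑ (map (x ∷_) S) h + ∑ S h
  ≡⟨ cong₂ _+_ nonempty (∑-sublists-[] xs h′[]≡0 e) ⟩
    ∑ (map (x ∷_) S) h′ + (h [] + ∑ S h′)
  ≡⟨ x∙yz≈y∙xz (∑ (map (x ∷_) S) h′) (h []) _ ⟩
    h [] + (∑ (map (x ∷_) S) h′ + ∑ S h′)
  ≡⟨ cong (h [] +_) (sym (∑-++ (map (x ∷_) S) S h′)) ⟩
    h [] + ∑ (map (x ∷_) S ++ S) h′
  ∎
  where
    open ≡-Reasoning
    S = sublists xs
    nonempty : ∑ (map (x ∷_) S) h ≡ ∑ (map (x ∷_) S) h′
    nonempty = trans (∑-map (x ∷_) S h) (trans (∑-cong S (e x)) (sym (∑-map (x ∷_) S h′)))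

module _ (_≟_ : DecidableEquality X) where

  count : X → List X → ℕ
  count v xs = length (filter (v ≟_) xs)

  count-∷-* : ∀ v x xs y → count v (x ∷ xs) * y ≡ [ v ≟ x ]· y + count v xs * y
  count-∷-* v x xs y with v ≟ x
  ... | yes _ = refl
  ... | no  _ = refl

  ∑-indicator-unique : ∀ {ys x} (h : X → ℕ) → Unique ys → x ∈ ys → ∑[ v ← ys ] [ v ≟ x ]· h v ≡ h x
  ∑-indicator-unique {y ∷ ys} h (y∉ys ∷ _) (here refl) = begin
      [ y ≟ y ]· h y + ∑[ v ← ys ] [ v ≟ y ]· h v
    ≡⟨ cong₂ _+_ ([]·-yes (y ≟ y) refl) (∑-cong-local y∉ys (λ {v} y≢v → []·-no (v ≟ y) (y≢v ∘ sym))) ⟩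
      h y + ∑[ v ← ys ] 0
    ≡⟨ cong (h y +_) (∑-zero ys) ⟩
      h y + 0
    ≡⟨ +-identityʳ (h y) ⟩
      h y
    ∎
    where open ≡-Reasoning
  ∑-indicator-unique {y ∷ ys} {x} h (y∉ys ∷ uniq) (there x∈ys) =
    cong₂ _+_ ([]·-no (y ≟ x) (All.lookup y∉ys x∈ys)) (∑-indicator-unique h uniq x∈ys)

  ∑-count-unique : ∀ {ys} xs (h : X → ℕ) → Unique ys → (∀ {x} → x ∈ xs → x ∈ ys) →
                   ∑ xs h ≡ ∑[ v ← ys ] count v xs * h v
  ∑-count-unique {ys} []       h uniq sub = sym (∑-zero ys)
  ∑-count-unique {ys} (x ∷ xs) h uniq sub = begin
      h x + ∑ xs h
    ≡⟨ cong₂ _+_ (sym (∑-indicator-unique h uniq (sub (here refl))))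
                 (∑-count-unique xs h uniq (λ x∈xs → sub (there x∈xs))) ⟩
      ∑[ v ← ys ] [ v ≟ x ]· h v + ∑[ v ← ys ] count v xs * h v
    ≡⟨ sym (∑-+ ys _ _) ⟩
      ∑[ v ← ys ] ([ v ≟ x ]· h v + count v xs * h v)
    ≡⟨ sym (∑-cong ys (λ v → count-∷-* v x xs (h v))) ⟩
      ∑[ v ← ys ] count v (x ∷ xs) * h v
    ∎
    where open ≡-Reasoning

  ∑-deduplicate : ∀ xs (h : X → ℕ) → ∑ xs h ≡ ∑[ v ← deduplicate _≟_ xs ] count v xs * h v
  ∑-deduplicate xs h = ∑-count-unique xs h (deduplicate-! _≟_ xs) (∈-deduplicate⁺ _≟_)

∑-allWords-suc : ∀ j (h : Word → ℕ) →
                 ∑ (allWords (suc j)) h ≡ ∑[ x ← allWords j ] h (𝟎 ∷ x) + ∑[ x ← allWords j ] h (𝟏 ∷ x)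
∑-allWords-suc j h =
  trans (∑-concatMap (λ x → (𝟎 ∷ x) ∷ (𝟏 ∷ x) ∷ []) (allWords j) h)
        (trans (∑-cong (allWords j) (λ x → cong (h (𝟎 ∷ x) +_) (+-identityʳ (h (𝟏 ∷ x)))))
               (∑-+ (allWords j) _ _))

binom-∷-heads : ∀ a w v →
  binom (a ∷ w) (𝟎 ∷ v) + binom (a ∷ w) (𝟏 ∷ v) ≡ binom w v + (binom w (𝟎 ∷ v) + binom w (𝟏 ∷ v))
binom-∷-heads 𝟎 w v = +-assoc (binom w v) _ _
binom-∷-heads 𝟏 w v = x∙yz≈y∙xz (binom w (𝟎 ∷ v)) (binom w v) _

∑-binom-∷-heads : ∀ a w xs →
  ∑[ v ← xs ] binom (a ∷ w) (𝟎 ∷ v) + ∑[ v ← xs ] binom (a ∷ w) (𝟏 ∷ v)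
  ≡ ∑ xs (binom w) + (∑[ v ← xs ] binom w (𝟎 ∷ v) + ∑[ v ← xs ] binom w (𝟏 ∷ v))
∑-binom-∷-heads a w xs = begin
    ∑[ v ← xs ] binom (a ∷ w) (𝟎 ∷ v) + ∑[ v ← xs ] binom (a ∷ w) (𝟏 ∷ v)
  ≡⟨ sym (∑-+ xs _ _) ⟩
    ∑[ v ← xs ] (binom (a ∷ w) (𝟎 ∷ v) + binom (a ∷ w) (𝟏 ∷ v))
  ≡⟨ ∑-cong xs (binom-∷-heads a w) ⟩
    ∑[ v ← xs ] (binom w v + (binom w (𝟎 ∷ v) + binom w (𝟏 ∷ v)))
  ≡⟨ trans (∑-+ xs _ _) (cong (∑ xs (binom w) +_) (∑-+ xs _ _)) ⟩
    ∑ xs (binom w) + (∑[ v ← xs ] binom w (𝟎 ∷ v) + ∑[ v ← xs ] binom w (𝟏 ∷ v))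
  ∎
  where open ≡-Reasoning

∑-binom-allWords : ∀ w j → ∑ (allWords j) (binom w) ≡ length w C j
∑-binom-allWords w       zero    = refl
∑-binom-allWords []      (suc j) =
  trans (∑-allWords-suc j (binom [])) (cong₂ _+_ (∑-zero (allWords j)) (∑-zero (allWords j)))
∑-binom-allWords (a ∷ w) (suc j) = begin
    ∑ (allWords (suc j)) (binom (a ∷ w))
  ≡⟨ ∑-allWords-suc j (binom (a ∷ w)) ⟩
    ∑[ x ← allWords j ] binom (a ∷ w) (𝟎 ∷ x) + ∑[ x ← allWords j ] binom (a ∷ w) (𝟏 ∷ x)
  ≡⟨ ∑-binom-∷-heads a w (allWords j) ⟩
    ∑ (allWords j) (binom w) + (∑[ x ← allWords j ] binom w (𝟎 ∷ x) + ∑[ x ← allWords j ] binom w (𝟏 ∷ x))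
  ≡⟨ cong (∑ (allWords j) (binom w) +_) (sym (∑-allWords-suc j (binom w))) ⟩
    ∑ (allWords j) (binom w) + ∑ (allWords (suc j)) (binom w)
  ≡⟨ cong₂ _+_ (∑-binom-allWords w j) (∑-binom-allWords w (suc j)) ⟩
    length w C j + length w C suc j
  ≡⟨ nCk+nC[k+1]≡[n+1]C[k+1] (length w) j ⟩
    suc (length w) C suc j
  ∎
  where open ≡-Reasoning

-- pullback u is the multiset sum of the 𝓛(u, κ) over all codes κ, the empty one included (so A^|u| ⊎ f(u)),
-- generated from the first letter b of u: either b lies in no block and contributes an arbitrary letter,
-- or u starts with the block φ(b), which contributes the single letter b.
mutual
  pullback : Word → List Word
  pullback []      = [] ∷ []
  pullback (b ∷ r) = map (b ∷_) (blockTail b r) ++ map (𝟎 ∷_) (pullback r) ++ map (𝟏 ∷_) (pullback r)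

  blockTail : A → Word → List Word
  blockTail b []       = []
  blockTail 𝟎 (𝟏 ∷ r) = pullback r
  blockTail 𝟏 (𝟎 ∷ r) = pullback r
  blockTail 𝟎 (𝟎 ∷ r) = []
  blockTail 𝟏 (𝟏 ∷ r) = []

∑-pullback-∷ : ∀ b r (h : Word → ℕ) → ∑ (pullback (b ∷ r)) h ≡
  ∑[ v ← blockTail b r ] h (b ∷ v) + (∑[ v ← pullback r ] h (𝟎 ∷ v) + ∑[ v ← pullback r ] h (𝟏 ∷ v))
∑-pullback-∷ b r h =
  trans (∑-++ (map (b ∷_) (blockTail b r)) _ h)
        (cong₂ _+_ (∑-map (b ∷_) (blockTail b r) h)
                   (trans (∑-++ (map (𝟎 ∷_) (pullback r)) _ h)
                          (cong₂ _+_ (∑-map (𝟎 ∷_) (pullback r) h) (∑-map (𝟏 ∷_) (pullback r) h))))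

afterφ : A → A → Word → List Word
afterφ 𝟎 𝟎 (𝟏 ∷ r) = r ∷ []
afterφ 𝟏 𝟏 (𝟎 ∷ r) = r ∷ []
afterφ _ _ _       = []

binom-φ-++ : ∀ a s b r → binom (φ a ++ s) (b ∷ r) ≡ ∑ (afterφ a b r) (binom s) + binom s r + binom s (b ∷ r)
binom-φ-++ 𝟎 s 𝟎 []      = refl
binom-φ-++ 𝟎 s 𝟎 (𝟎 ∷ r) = refl
binom-φ-++ 𝟎 s 𝟎 (𝟏 ∷ r) =
  cong (λ z → z + binom s (𝟏 ∷ r) + binom s (𝟎 ∷ 𝟏 ∷ r)) (sym (+-identityʳ (binom s r)))
binom-φ-++ 𝟎 s 𝟏 r       = refl
binom-φ-++ 𝟏 s 𝟏 []      = refl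
binom-φ-++ 𝟏 s 𝟏 (𝟏 ∷ r) = refl
binom-φ-++ 𝟏 s 𝟏 (𝟎 ∷ r) =
  cong (λ z → z + binom s (𝟎 ∷ r) + binom s (𝟏 ∷ 𝟎 ∷ r)) (sym (+-identityʳ (binom s r)))
binom-φ-++ 𝟏 s 𝟎 r       = refl

∑-blockTail-binom-∷ : ∀ a b r w →
  ∑[ v ← blockTail b r ] binom (a ∷ w) (b ∷ v)
  ≡ ∑[ r′ ← afterφ a b r ] ∑ (pullback r′) (binom w) + ∑[ v ← blockTail b r ] binom w (b ∷ v)
∑-blockTail-binom-∷ 𝟎 𝟎 []      w = refl
∑-blockTail-binom-∷ 𝟎 𝟎 (𝟎 ∷ r) w = refl
∑-blockTail-binom-∷ 𝟎 𝟎 (𝟏 ∷ r) w =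
  trans (∑-+ (pullback r) (binom w) (λ v → binom w (𝟎 ∷ v)))
        (cong (_+ ∑[ v ← pullback r ] binom w (𝟎 ∷ v)) (sym (+-identityʳ (∑ (pullback r) (binom w)))))
∑-blockTail-binom-∷ 𝟎 𝟏 r       w = refl
∑-blockTail-binom-∷ 𝟏 𝟏 []      w = refl
∑-blockTail-binom-∷ 𝟏 𝟏 (𝟏 ∷ r) w = refl
∑-blockTail-binom-∷ 𝟏 𝟏 (𝟎 ∷ r) w =
  trans (∑-+ (pullback r) (binom w) (λ v → binom w (𝟏 ∷ v)))
        (cong (_+ ∑[ v ← pullback r ] binom w (𝟏 ∷ v)) (sym (+-identityʳ (∑ (pullback r) (binom w)))))
∑-blockTail-binom-∷ 𝟏 𝟎 r       w = refl

binom-φ* : ∀ w u → binom (φ* w) u ≡ ∑ (pullback u) (binom w)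
binom-φ* []      []      = refl
binom-φ* []      (b ∷ r) = sym (trans (∑-pullback-∷ b r (binom []))
  (cong₂ _+_ (∑-zero (blockTail b r)) (cong₂ _+_ (∑-zero (pullback r)) (∑-zero (pullback r)))))
binom-φ* (a ∷ w) []      = refl
binom-φ* (a ∷ w) (b ∷ r) = begin
    binom (φ a ++ φ* w) (b ∷ r)
  ≡⟨ binom-φ-++ a (φ* w) b r ⟩
    ∑ (afterφ a b r) (binom (φ* w)) + binom (φ* w) r + binom (φ* w) (b ∷ r)
  ≡⟨ cong₂ _+_ (cong₂ _+_ (∑-cong (afterφ a b r) (binom-φ* w)) (binom-φ* w r)) (binom-φ* w (b ∷ r)) ⟩
    E + P r + P (b ∷ r)
  ≡⟨ cong (E + P r +_) (∑-pullback-∷ b r (binom w)) ⟩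
    E + P r + (∑[ v ← blockTail b r ] binom w (b ∷ v) + heads (binom w))
  ≡⟨ interchange E (P r) _ _ ⟩
    (E + ∑[ v ← blockTail b r ] binom w (b ∷ v)) + (P r + heads (binom w))
  ≡⟨ cong₂ _+_ (sym (∑-blockTail-binom-∷ a b r w)) (sym (∑-binom-∷-heads a w (pullback r))) ⟩
    ∑[ v ← blockTail b r ] binom (a ∷ w) (b ∷ v) + heads (binom (a ∷ w))
  ≡⟨ sym (∑-pullback-∷ b r (binom (a ∷ w))) ⟩
    P′ (b ∷ r)
  ∎
  where
    open ≡-Reasoning
    P P′ : Word → ℕ
    P  u = ∑ (pullback u) (binom w)
    P′ u = ∑ (pullback u) (binom (a ∷ w))
    E = ∑[ r′ ← afterφ a b r ] P r′
    heads : (Word → ℕ) → ℕ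
    heads h = ∑[ v ← pullback r ] h (𝟎 ∷ v) + ∑[ v ← pullback r ] h (𝟏 ∷ v)

range : ℕ → ℕ → List ℕ
range m zero    = []
range m (suc k) = m ∷ range (suc m) k

applyUpTo≡range : ∀ {f : ℕ → ℕ} m k → (∀ i → f i ≡ m + i) → applyUpTo f k ≡ range m k
applyUpTo≡range m zero    _ = refl
applyUpTo≡range m (suc k) e =
  cong₂ _∷_ (trans (e 0) (+-identityʳ m)) (applyUpTo≡range (suc m) k (λ i → trans (e (suc i)) (+-suc m i)))

upTo≡range : ∀ n → upTo n ≡ range 0 n
upTo≡range n = applyUpTo≡range 0 n (λ _ → refl)

range-≥ : ∀ m k → All (m ≤_) (range m k)
range-≥ m zero    = []
range-≥ m (suc k) = ≤-refl ∷ All.map <⇒≤ (range-≥ (suc m) k)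

sublists⁺ : ∀ {P : X → Set} {xs} → All P xs → All (All P) (sublists xs)
sublists⁺ []         = [] ∷ []
sublists⁺ (px ∷ pxs) = ++⁺ (map⁺ (All.map (px ∷_) (sublists⁺ pxs))) (sublists⁺ pxs)

drop-∷ : ∀ m (xs : List X) {y ys} → drop m xs ≡ y ∷ ys → drop (suc m) xs ≡ ys
drop-∷ zero    (x ∷ xs) refl = refl
drop-∷ (suc m) (x ∷ xs) eq   = drop-∷ m xs eq
drop-∷ zero    []       ()
drop-∷ (suc m) []       ()

length-drop-∷ : ∀ m (xs : List X) {y ys} → drop m xs ≡ y ∷ ys → length xs ≡ m + length (y ∷ ys)
length-drop-∷ zero    xs       eq = cong length eq
length-drop-∷ (suc m) (x ∷ xs) eq = cong suc (length-drop-∷ m xs eq)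
length-drop-∷ (suc m) []       ()

m<n⇒n∸m≡1+[n∸1+m] : ∀ {m n} → suc m ≤ n → n ∸ m ≡ suc (n ∸ suc m)
m<n⇒n∸m≡1+[n∸1+m] {n = suc n} (s≤s m≤n) = +-∸-assoc 1 m≤n

m+2≰m+1 : ∀ m → ¬ (m + 2 ≤ m + 1)
m+2≰m+1 m le = 1+n≰n (+-cancelˡ-≤ m 2 1 le)

-- PhiAt u m unfolds to IsφBlock (drop m u).
IsφBlock : Word → Set
IsφBlock t = (take 2 t ≡ φ 𝟎) ⊎ (take 2 t ≡ φ 𝟏)

repeat-notφBlock : ∀ b r → ¬ IsφBlock (b ∷ b ∷ r)
repeat-notφBlock 𝟎 r (inj₁ ())
repeat-notφBlock 𝟎 r (inj₂ ())
repeat-notφBlock 𝟏 r (inj₁ ())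
repeat-notφBlock 𝟏 r (inj₂ ())

module _ (u : Word) where

  langSum : ℕ → (Word → ℕ) → List ℕ → ℕ
  langSum m g κ = ∑ (LangFrom u m κ) g

  codeTerm : ℕ → (Word → ℕ) → List ℕ → ℕ
  codeTerm m g κ = [ CodesFrom? u m κ ]· langSum m g κ

  codeSum : ℕ → ℕ → (Word → ℕ) → ℕ
  codeSum m k g = ∑ (sublists (range m k)) (codeTerm m g)

  codesAt : ℕ → ℕ → (Word → ℕ) → ℕ
  codesAt m k g = ∑[ κ ← sublists (range (suc m) k) ] codeTerm m g (m ∷ κ)

  CodesFrom-start : ∀ {m m′} κ → All (m′ ≤_) κ → CodesFrom u m κ → CodesFrom u m′ κ
  CodesFrom-start []       _          _          = tt
  CodesFrom-start (p ∷ ps) (m′≤p ∷ _) (_ , rest) = m′≤p , rest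

  langSum-∷ : ∀ m g p κ →
    langSum m g (p ∷ κ) ≡ ∑[ x ← allWords (p ∸ m) ] langSum (p + 2) (λ y → g (x ++ take 1 (drop p u) ++ y)) κ
  langSum-∷ m g p κ =
    trans (∑-concatMap _ (allWords (p ∸ m)) g)
          (∑-cong (allWords (p ∸ m)) (λ x → ∑-map _ (LangFrom u (p + 2) κ) g))

  langSum-split : ∀ {m} κ g → suc m ≤ length u → All (suc m ≤_) κ →
    langSum m g κ ≡ langSum (suc m) (λ v → g (𝟎 ∷ v)) κ + langSum (suc m) (λ v → g (𝟏 ∷ v)) κ
  langSum-split {m} []      g m<n _ =
    trans (cong (λ j → ∑ (allWords j) g) (m<n⇒n∸m≡1+[n∸1+m] m<n)) (∑-allWords-suc (length u ∸ suc m) g)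
  langSum-split {m} (p ∷ κ) g _ (m<p ∷ _) = begin
      langSum m g (p ∷ κ)
    ≡⟨ langSum-∷ m g p κ ⟩
      ∑ (allWords (p ∸ m)) F
    ≡⟨ cong (λ j → ∑ (allWords j) F) (m<n⇒n∸m≡1+[n∸1+m] m<p) ⟩
      ∑ (allWords (suc (p ∸ suc m))) F
    ≡⟨ ∑-allWords-suc (p ∸ suc m) F ⟩
      ∑[ x ← allWords (p ∸ suc m) ] F (𝟎 ∷ x) + ∑[ x ← allWords (p ∸ suc m) ] F (𝟏 ∷ x)
    ≡⟨ sym (cong₂ _+_ (langSum-∷ (suc m) _ p κ) (langSum-∷ (suc m) _ p κ)) ⟩
      langSum (suc m) (λ v → g (𝟎 ∷ v)) (p ∷ κ) + langSum (suc m) (λ v → g (𝟏 ∷ v)) (p ∷ κ)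
    ∎
    where
      open ≡-Reasoning
      F : Word → ℕ
      F x = langSum (p + 2) (λ y → g (x ++ take 1 (drop p u) ++ y)) κ

  langSum-block : ∀ {m b c r} κ g → drop m u ≡ b ∷ c ∷ r →
    langSum m g (m ∷ κ) ≡ langSum (suc (suc m)) (λ v → g (b ∷ v)) κ
  langSum-block {m} {b} κ g eq = begin
      langSum m g (m ∷ κ)
    ≡⟨ langSum-∷ m g m κ ⟩
      ∑[ x ← allWords (m ∸ m) ] F x
    ≡⟨ cong (λ j → ∑[ x ← allWords j ] F x) (n∸n≡0 m) ⟩
      F [] + 0
    ≡⟨ +-identityʳ (F []) ⟩
      langSum (m + 2) (λ y → g (take 1 (drop m u) ++ y)) κ
    ≡⟨ cong₂ (λ p c → langSum p (λ y → g (c ++ y)) κ) (+-comm m 2) (cong (take 1) eq) ⟩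
      langSum (suc (suc m)) (λ v → g (b ∷ v)) κ
    ∎
    where
      open ≡-Reasoning
      F : Word → ℕ
      F x = langSum (m + 2) (λ y → g (x ++ take 1 (drop m u) ++ y)) κ

  codeTerm-split : ∀ {m} κ g → suc m ≤ length u → All (suc m ≤_) κ →
    codeTerm m g κ ≡ codeTerm (suc m) (λ v → g (𝟎 ∷ v)) κ + codeTerm (suc m) (λ v → g (𝟏 ∷ v)) κ
  codeTerm-split {m} κ g m<n above =
    trans ([]·-cong (CodesFrom? u m κ) (CodesFrom? u (suc m) κ)
                    (CodesFrom-start κ above) (CodesFrom-start κ (All.map <⇒≤ above))
                    (langSum-split κ g m<n above))
          ([]·-+ (CodesFrom? u (suc m) κ) _ _)

  codeTerm-block : ∀ {m b c r} κ g → drop m u ≡ b ∷ c ∷ r → IsφBlock (b ∷ c ∷ r) →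
    codeTerm m g (m ∷ κ) ≡ codeTerm (suc (suc m)) (λ v → g (b ∷ v)) κ
  codeTerm-block {m} κ g eq block =
    []·-cong (CodesFrom? u m (m ∷ κ)) (CodesFrom? u (suc (suc m)) κ)
      (λ (_ , _ , _ , codes) → subst (λ p → CodesFrom u p κ) (+-comm m 2) codes)
      (λ codes → ≤-refl , m+2≤n , subst IsφBlock (sym eq) block ,
                 subst (λ p → CodesFrom u p κ) (+-comm 2 m) codes)
      (langSum-block κ g eq)
    where
      m+2≤n : m + 2 ≤ length u
      m+2≤n = subst (m + 2 ≤_) (sym (length-drop-∷ m u eq)) (+-monoʳ-≤ m (s≤s (s≤s z≤n)))

  codesAt-block : ∀ {m b c r} → drop m u ≡ b ∷ c ∷ r → IsφBlock (b ∷ c ∷ r) → ∀ g →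
    codesAt m (suc (length r)) g ≡ codeSum (suc (suc m)) (length r) (λ v → g (b ∷ v))
  codesAt-block {m} {r = r} eq block g =
    trans (∑-++ (map (suc m ∷_) S) S _)
          (cong₂ _+_ (trans (∑-map (suc m ∷_) S _) (trans (∑-cong S overlapping) (∑-zero S)))
                     (∑-cong S (λ κ → codeTerm-block κ g eq block)))
    where
      S = sublists (range (suc (suc m)) (length r))
      overlapping : ∀ κ → codeTerm m g (m ∷ suc m ∷ κ) ≡ 0
      overlapping κ = []·-no (CodesFrom? u m (m ∷ suc m ∷ κ))
        (λ (_ , _ , _ , m+2≤1+m , _) → m+2≰m+1 m (subst (m + 2 ≤_) (+-comm 1 m) m+2≤1+m))

  codesAt-last : ∀ {m b} → drop m u ≡ b ∷ [] → ∀ g → codesAt m 0 g ≡ 0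
  codesAt-last {m} eq g = cong (_+ 0) ([]·-no (CodesFrom? u m (m ∷ []))
    (λ (_ , m+2≤n , _) → m+2≰m+1 m (subst (m + 2 ≤_) (length-drop-∷ m u eq) m+2≤n)))

  codesAt-repeat : ∀ {m b r} → drop m u ≡ b ∷ b ∷ r → ∀ k g → codesAt m k g ≡ 0
  codesAt-repeat {m} {b} {r} eq k g =
    trans (∑-cong (sublists (range (suc m) k))
                  (λ κ → []·-no (CodesFrom? u m (m ∷ κ))
                                (λ (_ , _ , block , _) → repeat-notφBlock b r (subst IsφBlock eq block))))
          (∑-zero (sublists (range (suc m) k)))

  codesAfter-split : ∀ {m b r} → drop m u ≡ b ∷ r → ∀ k g →
    ∑ (sublists (range (suc m) k)) (codeTerm m g)
    ≡ codeSum (suc m) k (λ v → g (𝟎 ∷ v)) + codeSum (suc m) k (λ v → g (𝟏 ∷ v))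
  codesAfter-split {m} eq k g =
    trans (∑-cong-local (sublists⁺ (range-≥ (suc m) k)) (λ {κ} above → codeTerm-split κ g m<n above))
          (∑-+ (sublists (range (suc m) k)) _ _)
    where
      m<n : suc m ≤ length u
      m<n = subst (suc m ≤_) (sym (length-drop-∷ m u eq)) (m<m+n m (s≤s z≤n))

  mutual
    codeSum-pullback : ∀ m t → drop m u ≡ t → ∀ g → codeSum m (length t) g ≡ ∑ (pullback t) g
    codeSum-pullback m []      eq g =
      trans (+-identityʳ _) (cong (λ j → ∑ (allWords j) g) (trans (sym (length-drop m u)) (cong length eq)))
    codeSum-pullback m (b ∷ r) eq g = begin
        codeSum m (suc (length r)) g
      ≡⟨ trans (∑-++ (map (m ∷_) S) S _) (cong (_+ ∑ S (codeTerm m g)) (∑-map (m ∷_) S _)) ⟩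
        codesAt m (length r) g + ∑ S (codeTerm m g)
      ≡⟨ cong₂ _+_ (codesAt-blockTail m b r eq g) (codesAfter-split eq (length r) g) ⟩
        ∑[ v ← blockTail b r ] g (b ∷ v) + (codeSum (suc m) (length r) g₀ + codeSum (suc m) (length r) g₁)
      ≡⟨ cong (∑[ v ← blockTail b r ] g (b ∷ v) +_) (cong₂ _+_ (next g₀) (next g₁)) ⟩
        ∑[ v ← blockTail b r ] g (b ∷ v) + (∑ (pullback r) g₀ + ∑ (pullback r) g₁)
      ≡⟨ sym (∑-pullback-∷ b r g) ⟩
        ∑ (pullback (b ∷ r)) g
      ∎
      where
        open ≡-Reasoning
        S = sublists (range (suc m) (length r))
        g₀ g₁ : Word → ℕ
        g₀ v = g (𝟎 ∷ v)
        g₁ v = g (𝟏 ∷ v)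
        next : ∀ h → codeSum (suc m) (length r) h ≡ ∑ (pullback r) h
        next = codeSum-pullback (suc m) r (drop-∷ m u eq)

    codesAt-blockTail : ∀ m b r → drop m u ≡ b ∷ r → ∀ g →
      codesAt m (length r) g ≡ ∑[ v ← blockTail b r ] g (b ∷ v)
    codesAt-blockTail m b []       eq g = codesAt-last {m} eq g
    codesAt-blockTail m 𝟎 (𝟏 ∷ r) eq g =
      trans (codesAt-block eq (inj₁ refl) g) (codeSum-pullback (suc (suc m)) r (drop-∷ (suc m) u (drop-∷ m u eq)) _)
    codesAt-blockTail m 𝟏 (𝟎 ∷ r) eq g =
      trans (codesAt-block eq (inj₂ refl) g) (codeSum-pullback (suc (suc m)) r (drop-∷ (suc m) u (drop-∷ m u eq)) _)
    codesAt-blockTail m 𝟎 (𝟎 ∷ r) eq g = codesAt-repeat {m} eq (suc (length r)) g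
    codesAt-blockTail m 𝟏 (𝟏 ∷ r) eq g = codesAt-repeat {m} eq (suc (length r)) g

theorem3p9 : (u w : Word) →
    (binom (φ* w) u ≡ length w C length u + sumPhifac u w)
    × (length w C length u + sumPhifac u w ≡ length w C length u + sumF u w)
theorem3p9 u w = φ-expansion , cong (length w C length u +_) sumPhifac≡sumF
  where
    open ≡-Reasoning
    H : List ℕ → ℕ
    H κ = ∑ (𝓛 u κ) (binom w)
    φ-expansion : binom (φ* w) u ≡ length w C length u + sumPhifac u w
    φ-expansion = begin
        binom (φ* w) u
      ≡⟨ binom-φ* w u ⟩
        ∑ (pullback u) (binom w)
      ≡⟨ sym (codeSum-pullback u 0 u refl (binom w)) ⟩
        ∑ (sublists (range 0 (length u))) (codeTerm u 0 (binom w))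
      ≡⟨ cong (λ ps → ∑ (sublists ps) (codeTerm u 0 (binom w))) (sym (upTo≡range (length u))) ⟩
        ∑ (sublists (upTo (length u))) (codeTerm u 0 (binom w))
      ≡⟨ ∑-sublists-[] (upTo (length u)) {h′ = λ κ → [ IsPhifacCode? u κ ]· H κ} refl (λ _ _ → refl) ⟩
        H [] + ∑[ κ ← sublists (upTo (length u)) ] [ IsPhifacCode? u κ ]· H κ
      ≡⟨ cong₂ _+_ (∑-binom-allWords w (length u))
                   (sym (∑-filter (IsPhifacCode? u) (sublists (upTo (length u))) H)) ⟩
        length w C length u + sumPhifac u w
      ∎
    sumPhifac≡sumF : sumPhifac u w ≡ sumF u w
    sumPhifac≡sumF = trans (sym (∑-concatMap (𝓛 u) (Phifac u) (binom w))) (∑-deduplicate _≟W_ (f u) (binom w))
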